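{- Let $\ell$ be an odd prime, $n$ a positive integer and $t$ an integer, and let $\Phi(x)=T_\ell^n(x)-t$. Then $\Phi(t)\equiv 0\pmod{\ell^2}$ if and only if there exists $a\in\mathbb{Z}/\ell^2\mathbb{Z}$ with $t\equiv T_\ell(a)\pmod{\ell^2}$.
   Context: $T_d(x)$ is the Chebyshev polynomial of the first kind of degree $d$ (the unique monic polynomial with $T_d(z+z^{ -1})=z^d+z^{ -d}$; it has integer coefficients), and $T_\ell^n$ denotes the $n$-fold composition of $T_\ell$; thus $\Phi(t)=T_\ell^n(t)-t$. -}

module Defs where

open import Data.Nat using (ℕ; zero; suc)
open import Data.Integer using (ℤ; _*_; _-_; +_)

-- Chebyshev polynomial of the first kind in the paper's (monic) normalisation,
-- evaluated at an integer: T d (z + z⁻¹) = z^d + z^-d, i.e.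
-- T 0 = 2, T 1 = x, T (d+2) = x·T (d+1) − T d.
T : ℕ → ℤ → ℤ
T zero          x = + 2
T (suc zero)    x = x
T (suc (suc d)) x = x * T (suc d) x - T d x

_^[_] : (ℤ → ℤ) → ℕ → ℤ → ℤ
(f ^[ zero ])  x = x
(f ^[ suc n ]) x = f ((f ^[ n ]) x)

Φ : ℕ → ℕ → ℤ → ℤ → ℤ
Φ ℓ n t x = (T ℓ ^[ n ]) x - t

-- Modulo ℓ the Frobenius identity T ℓ x ≡ x ^ ℓ ≡ x holds: iterating the recurrence
-- x · T i = T (i + 1) + T (i − 1) expands 2 x ^ ℓ = x ^ ℓ · T 0 into Σₖ (ℓ C k) T (ℓ − 2k), and all
-- terms but the outer two are divisible by ℓ. Since the derivative of T ℓ is ℓ · U ℓ, a Taylor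
-- expansion shows that T ℓ turns congruences modulo ℓ into congruences modulo ℓ². Hence if
-- t ≡ T ℓ a (mod ℓ²), then t ≡ a (mod ℓ), so T ℓ t ≡ T ℓ a ≡ t (mod ℓ²) and t is fixed modulo ℓ² by
-- every iterate of T ℓ. Conversely a = T ℓ^(n−1) t is a preimage.
module Submission where

open import Defs
open import Data.Nat using (ℕ; _%_; _≥_; _^_)
open import Data.Nat.Primality using (Prime)
open import Data.Integer using (ℤ; +_; _-_)
open import Data.Integer.Divisibility using (_∣_)
open import Data.Product using (∃; _×_)
open import Function.Bundles using (_⇔_)
open import Relation.Binary.PropositionalEquality using (_≡_)

import Data.Nat as ℕ
open import Data.Nat using (zero; suc; _<_; _≤_; _!; _∸_; s≤s; z≤n)
open import Data.Nat.Properties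
  using (<⇒≱; <⇒≤; n<1+n; <-trans; ∸-monoʳ-<; _!*_!≢0; *-identityʳ)
open import Data.Nat.Divisibility using (∣⇒≤; ∣1⇒≡1; m∣m*n) renaming (_∣_ to _∣ⁿ_)
open import Data.Nat.DivMod using (m/n*n≡m)
open import Data.Nat.Primality using (euclidsLemma; ¬prime[1])
open import Data.Nat.Combinatorics
  using (_C_; nCk≡n!/k![n-k]!; k![n∸k]!∣n!; k>n⇒nCk≡0; nCn≡1; nCk+nC[k+1]≡[n+1]C[k+1])
open import Data.Integer
  using (_+_; _*_; -_; 0ℤ; 1ℤ; -1ℤ; ∣_∣; -[1+_]) renaming (_^_ to _^ᶻ_)
open import Data.Integer.Properties
  using (+-assoc; +-identityʳ; +-identityˡ; *-identityˡ; *-comm; *-distribˡ-+; *-distribʳ-+; pos-*;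
         abs-*; ∣-i∣≡∣i∣)
open import Data.Integer.Divisibility.Signed
  using (divides; ∣-trans; ∣m∣n⇒∣m+n; ∣m⇒∣-m; ∣n⇒∣m*n; ∣m⇒∣m*n; ∣ᵤ⇒∣; ∣⇒∣ᵤ)
  renaming (_∣_ to _∣ₛ_)
open import Data.Integer.Tactic.RingSolver using (solve-∀)
open import Data.Product using (_,_)
open import Data.Sum using (inj₁; inj₂)
open import Function.Bundles using (mk⇔)
open import Relation.Binary.Bundles using (Setoid)
open import Relation.Binary.Structures using (IsEquivalence)
open import Relation.Binary.PropositionalEquality
  using (refl; sym; trans; cong; cong₂; subst; module ≡-Reasoning)
import Relation.Binary.Reasoning.Setoid as SetoidReasoning
open import Relation.Nullary using (¬_; contradiction)

infix 4 _≡_mod_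
record _≡_mod_ (x y m : ℤ) : Set where
  constructor congruent
  field
    divides-difference : m ∣ₛ x - y

module _ {m : ℤ} where

  mod-reflexive : ∀ {x y} → x ≡ y → x ≡ y mod m
  mod-reflexive {x} refl = congruent (divides 0ℤ (rearrange x m))
    where
    rearrange : ∀ x m → x - x ≡ 0ℤ * m
    rearrange = solve-∀

  mod-refl : ∀ {x} → x ≡ x mod m
  mod-refl = mod-reflexive refl

  mod-sym : ∀ {x y} → x ≡ y mod m → y ≡ x mod m
  mod-sym {x} {y} (congruent m∣x-y) = congruent (subst (m ∣ₛ_) (rearrange x y) (∣m⇒∣-m m∣x-y))
    where
    rearrange : ∀ x y → - (x - y) ≡ y - x
    rearrange = solve-∀

  mod-trans : ∀ {x y z} → x ≡ y mod m → y ≡ z mod m → x ≡ z mod m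
  mod-trans {x} {y} {z} (congruent m∣x-y) (congruent m∣y-z) =
    congruent (subst (m ∣ₛ_) (rearrange x y z) (∣m∣n⇒∣m+n m∣x-y m∣y-z))
    where
    rearrange : ∀ x y z → (x - y) + (y - z) ≡ x - z
    rearrange = solve-∀

  mod-+-cong : ∀ {x y u v} → x ≡ y mod m → u ≡ v mod m → x + u ≡ y + v mod m
  mod-+-cong {x} {y} {u} {v} (congruent m∣x-y) (congruent m∣u-v) =
    congruent (subst (m ∣ₛ_) (rearrange x y u v) (∣m∣n⇒∣m+n m∣x-y m∣u-v))
    where
    rearrange : ∀ x y u v → (x - y) + (u - v) ≡ (x + u) - (y + v)
    rearrange = solve-∀

  mod-+-congˡ : ∀ a {x y} → x ≡ y mod m → a + x ≡ a + y mod m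
  mod-+-congˡ a = mod-+-cong (mod-refl {a})

  mod-+-congʳ : ∀ a {x y} → x ≡ y mod m → x + a ≡ y + a mod m
  mod-+-congʳ a x≡y = mod-+-cong x≡y (mod-refl {a})

  mod-neg-cong : ∀ {x y} → x ≡ y mod m → - x ≡ - y mod m
  mod-neg-cong {x} {y} (congruent m∣x-y) = congruent (subst (m ∣ₛ_) (rearrange x y) (∣m⇒∣-m m∣x-y))
    where
    rearrange : ∀ x y → - (x - y) ≡ - x - - y
    rearrange = solve-∀

  mod-*-cong : ∀ {x y u v} → x ≡ y mod m → u ≡ v mod m → x * u ≡ y * v mod m
  mod-*-cong {x} {y} {u} {v} (congruent m∣x-y) (congruent m∣u-v) =
    congruent (subst (m ∣ₛ_) (rearrange x y u v) (∣m∣n⇒∣m+n (∣n⇒∣m*n x m∣u-v) (∣m⇒∣m*n v m∣x-y)))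
    where
    rearrange : ∀ x y u v → x * (u - v) + (x - y) * v ≡ x * u - y * v
    rearrange = solve-∀

  mod-*-congˡ : ∀ a {x y} → x ≡ y mod m → a * x ≡ a * y mod m
  mod-*-congˡ a = mod-*-cong (mod-refl {a})

  mod-*-congʳ : ∀ a {x y} → x ≡ y mod m → x * a ≡ y * a mod m
  mod-*-congʳ a x≡y = mod-*-cong x≡y (mod-refl {a})

  mod-+-multiple : ∀ x k → x + k * m ≡ x mod m
  mod-+-multiple x k = congruent (divides k (rearrange x k m))
    where
    rearrange : ∀ x k m → x + k * m - x ≡ k * m
    rearrange = solve-∀

  mod-isEquivalence : IsEquivalence (_≡_mod m)
  mod-isEquivalence = record { refl = mod-refl ; sym = mod-sym ; trans = mod-trans }

mod-setoid : ℤ → Setoid _ _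
mod-setoid m = record { isEquivalence = mod-isEquivalence {m} }

module ≡-mod-Reasoning (m : ℤ) = SetoidReasoning (mod-setoid m)

mod-∣ : ∀ {m n x y} → n ∣ₛ m → x ≡ y mod m → x ≡ y mod n
mod-∣ n∣m (congruent m∣x-y) = congruent (∣-trans n∣m m∣x-y)

∣⇒≡0-mod : ∀ {m x} → m ∣ₛ x → x ≡ 0ℤ mod m
∣⇒≡0-mod {m} {x} m∣x = congruent (subst (m ∣ₛ_) (sym (+-identityʳ x)) m∣x)

p∤m! : ∀ {p m} → Prime p → m < p → ¬ p ∣ⁿ m !
p∤m! {m = zero}  pr _   p∣1  = ¬prime[1] (subst Prime (∣1⇒≡1 p∣1) pr)
p∤m! {m = suc m} pr m<p p∣m! with euclidsLemma (suc m) (m !) pr p∣m!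
... | inj₁ p∣1+m = <⇒≱ m<p (∣⇒≤ p∣1+m)
... | inj₂ p∣m!′ = p∤m! pr (<-trans (n<1+n m) m<p) p∣m!′

nCk*[k!*[n∸k]!]≡n! : ∀ {n k} → k ≤ n → (n C k) ℕ.* (k ! ℕ.* (n ∸ k) !) ≡ n !
nCk*[k!*[n∸k]!]≡n! {n} {k} k≤n =
  subst (λ c → c ℕ.* (k ! ℕ.* (n ∸ k) !) ≡ n !) (sym (nCk≡n!/k![n-k]! k≤n))
    (m/n*n≡m (k![n∸k]!∣n! k≤n))
  where instance _ = k !* (n ∸ k) !≢0

p∣pCk : ∀ {p k} → Prime p → 0 < k → k < p → p ∣ⁿ p C k
p∣pCk {suc q} {k} pr 0<k k<p
  with euclidsLemma (suc q C k) (k ! ℕ.* (suc q ∸ k) !) pr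
         (subst (suc q ∣ⁿ_) (sym (nCk*[k!*[n∸k]!]≡n! (<⇒≤ k<p))) (m∣m*n (q !)))
... | inj₁ p∣C = p∣C
... | inj₂ p∣k!*[p-k]! with euclidsLemma (k !) ((suc q ∸ k) !) pr p∣k!*[p-k]!
...   | inj₁ p∣k!     = contradiction p∣k! (p∤m! pr k<p)
...   | inj₂ p∣[p-k]! = contradiction p∣[p-k]! (p∤m! pr (∸-monoʳ-< 0<k (<⇒≤ k<p)))

odd-prime∤2 : ∀ {p} → Prime p → p % 2 ≡ 1 → ¬ p ∣ⁿ 2
odd-prime∤2 {suc (suc zero)}    _ () _
odd-prime∤2 {suc (suc (suc _))} _ _  p∣2 with ∣⇒≤ p∣2
... | s≤s (s≤s ())

mod-*-cancelˡ-2 : ∀ {p x y} → Prime p → p % 2 ≡ 1 → + 2 * x ≡ + 2 * y mod + p → x ≡ y mod + p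
mod-*-cancelˡ-2 {p} {x} {y} pr odd (congruent p∣2x-2y)
  with euclidsLemma 2 ∣ x - y ∣ pr
         (subst (p ∣ⁿ_) (trans (cong ∣_∣ (rearrange x y)) (abs-* (+ 2) (x - y))) (∣⇒∣ᵤ p∣2x-2y))
  where
  rearrange : ∀ x y → + 2 * x - + 2 * y ≡ + 2 * (x - y)
  rearrange = solve-∀
... | inj₁ p∣2   = contradiction p∣2 (odd-prime∤2 pr odd)
... | inj₂ p∣x-y = congruent (∣ᵤ⇒∣ p∣x-y)

sumUpTo : ℕ → (ℕ → ℤ) → ℤ
sumUpTo zero    g = g 0
sumUpTo (suc n) g = g 0 + sumUpTo n (λ k → g (suc k))

sumUpTo-cong : ∀ n {f g : ℕ → ℤ} → (∀ k → f k ≡ g k) → sumUpTo n f ≡ sumUpTo n g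
sumUpTo-cong zero    f≗g = f≗g 0
sumUpTo-cong (suc n) f≗g = cong₂ _+_ (f≗g 0) (sumUpTo-cong n (λ k → f≗g (suc k)))

sumUpTo-distrib-+ : ∀ n f g → sumUpTo n (λ k → f k + g k) ≡ sumUpTo n f + sumUpTo n g
sumUpTo-distrib-+ zero    f g = refl
sumUpTo-distrib-+ (suc n) f g =
  trans (cong (_+_ (f 0 + g 0)) (sumUpTo-distrib-+ n _ _)) (rearrange (f 0) (g 0) _ _)
  where
  rearrange : ∀ a b c d → a + b + (c + d) ≡ (a + c) + (b + d)
  rearrange = solve-∀

sumUpTo-suc : ∀ n g → sumUpTo (suc n) g ≡ sumUpTo n g + g (suc n)
sumUpTo-suc zero    g = refl
sumUpTo-suc (suc n) g =
  trans (cong (_+_ (g 0)) (sumUpTo-suc n _)) (sym (+-assoc (g 0) _ _))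

sumUpTo-≡0-mod : ∀ {m} n g → (∀ k → k ≤ n → g k ≡ 0ℤ mod m) → sumUpTo n g ≡ 0ℤ mod m
sumUpTo-≡0-mod zero    g g≡0 = g≡0 0 z≤n
sumUpTo-≡0-mod (suc n) g g≡0 =
  mod-+-cong (g≡0 0 z≤n) (sumUpTo-≡0-mod n _ (λ k k≤n → g≡0 (suc k) (s≤s k≤n)))

binomialSum : ℕ → (ℕ → ℤ) → ℤ
binomialSum zero    f = f 0
binomialSum (suc d) f = binomialSum d f + binomialSum d (λ k → f (suc k))

binomialSum-cong : ∀ d {f g : ℕ → ℤ} → (∀ k → f k ≡ g k) → binomialSum d f ≡ binomialSum d g
binomialSum-cong zero    f≗g = f≗g 0
binomialSum-cong (suc d) f≗g =
  cong₂ _+_ (binomialSum-cong d f≗g) (binomialSum-cong d (λ k → f≗g (suc k)))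

binomialSum-*ˡ : ∀ c d f → c * binomialSum d f ≡ binomialSum d (λ k → c * f k)
binomialSum-*ˡ c zero    f = refl
binomialSum-*ˡ c (suc d) f =
  trans (*-distribˡ-+ c _ _) (cong₂ _+_ (binomialSum-*ˡ c d f) (binomialSum-*ˡ c d _))

binomialSum≡sumUpTo : ∀ d f → binomialSum d f ≡ sumUpTo d (λ k → + (d C k) * f k)
binomialSum≡sumUpTo zero    f = sym (*-identityˡ (f 0))
binomialSum≡sumUpTo (suc d) f = begin
  binomialSum d f + binomialSum d f′
    ≡⟨ cong₂ _+_ (binomialSum≡sumUpTo d f) (binomialSum≡sumUpTo d f′) ⟩
  sumUpTo d (λ k → + (d C k) * f k) + sumUpTo d (λ k → + (d C k) * f′ k)
    ≡⟨ cong (_+ sumUpTo d (λ k → + (d C k) * f′ k)) drop-last ⟩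
  (+ 1 * f 0 + sumUpTo d (λ k → + (d C suc k) * f′ k)) + sumUpTo d (λ k → + (d C k) * f′ k)
    ≡⟨ rearrange (+ 1 * f 0) _ _ ⟩
  + 1 * f 0 + (sumUpTo d (λ k → + (d C k) * f′ k) + sumUpTo d (λ k → + (d C suc k) * f′ k))
    ≡⟨ cong (_+_ (+ 1 * f 0)) (sym (sumUpTo-distrib-+ d _ _)) ⟩
  + 1 * f 0 + sumUpTo d (λ k → + (d C k) * f′ k + + (d C suc k) * f′ k)
    ≡⟨ cong (_+_ (+ 1 * f 0)) (sumUpTo-cong d pascal) ⟩
  + 1 * f 0 + sumUpTo d (λ k → + (suc d C suc k) * f′ k) ∎
  where
  open ≡-Reasoning
  f′ : ℕ → ℤ
  f′ k = f (suc k)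
  rearrange : ∀ a b c → (a + b) + c ≡ a + (c + b)
  rearrange = solve-∀
  drop-last : sumUpTo d (λ k → + (d C k) * f k) ≡ + 1 * f 0 + sumUpTo d (λ k → + (d C suc k) * f′ k)
  drop-last = begin
    sumUpTo d (λ k → + (d C k) * f k)
      ≡⟨ +-identityʳ _ ⟨
    sumUpTo d (λ k → + (d C k) * f k) + + 0 * f (suc d)
      ≡⟨ cong (λ c → sumUpTo d (λ k → + (d C k) * f k) + + c * f (suc d)) (k>n⇒nCk≡0 (n<1+n d)) ⟨
    sumUpTo d (λ k → + (d C k) * f k) + + (d C suc d) * f (suc d)
      ≡⟨ sumUpTo-suc d _ ⟨
    sumUpTo (suc d) (λ k → + (d C k) * f k) ∎
  pascal : ∀ k → + (d C k) * f′ k + + (d C suc k) * f′ k ≡ + (suc d C suc k) * f′ k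
  pascal k = trans (sym (*-distribʳ-+ (f′ k) (+ (d C k)) (+ (d C suc k))))
                   (cong (λ c → + c * f′ k) (nCk+nC[k+1]≡[n+1]C[k+1] d k))

binomialSum-prime : ∀ {p} → Prime p → ∀ f → binomialSum p f ≡ f 0 + f p mod + p
binomialSum-prime {p@(suc (suc q))} pr f = begin
  binomialSum p f                                   ≡⟨ binomialSum≡sumUpTo p f ⟩
  g 0 + sumUpTo (suc q) (λ k → g (suc k))           ≡⟨ cong (_+_ (g 0)) (sumUpTo-suc q _) ⟩
  g 0 + (sumUpTo q (λ k → g (suc k)) + g p)
    ≈⟨ mod-+-congˡ (g 0) (mod-+-congʳ (g p) interior≡0) ⟩
  g 0 + (0ℤ + g p)                                  ≡⟨ cong₂ _+_ (*-identityˡ (f 0)) outer ⟩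
  f 0 + f p                                         ∎
  where
  open ≡-mod-Reasoning (+ p)
  g : ℕ → ℤ
  g k = + (p C k) * f k
  interior≡0 : sumUpTo q (λ k → g (suc k)) ≡ 0ℤ mod + p
  interior≡0 = sumUpTo-≡0-mod q _ λ k k≤q →
    mod-*-congʳ (f (suc k))
      (∣⇒≡0-mod (∣ᵤ⇒∣ {i = + (p C suc k)} (p∣pCk pr (s≤s z≤n) (s≤s (s≤s k≤q)))))
  outer : 0ℤ + g p ≡ f p
  outer = trans (+-identityˡ (g p)) (trans (cong (λ c → + c * f p) (nCn≡1 p)) (*-identityˡ (f p)))

-- Fermat's little theorem

[1+y]^d≡binomialSum : ∀ y d → (1ℤ + y) ^ᶻ d ≡ binomialSum d (y ^ᶻ_)
[1+y]^d≡binomialSum y zero    = refl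
[1+y]^d≡binomialSum y (suc d) = begin
  (1ℤ + y) * (1ℤ + y) ^ᶻ d                    ≡⟨ *-distribʳ-+ _ 1ℤ y ⟩
  1ℤ * (1ℤ + y) ^ᶻ d + y * (1ℤ + y) ^ᶻ d      ≡⟨ cong (_+ y * (1ℤ + y) ^ᶻ d) (*-identityˡ ((1ℤ + y) ^ᶻ d)) ⟩
  (1ℤ + y) ^ᶻ d + y * (1ℤ + y) ^ᶻ d           ≡⟨ cong₂ (λ a b → a + y * b) IH IH ⟩
  binomialSum d (y ^ᶻ_) + y * binomialSum d (y ^ᶻ_)
    ≡⟨ cong (_+_ (binomialSum d (y ^ᶻ_))) (binomialSum-*ˡ y d _) ⟩
  binomialSum d (y ^ᶻ_) + binomialSum d (λ k → y ^ᶻ suc k) ∎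
  where
  open ≡-Reasoning
  IH : (1ℤ + y) ^ᶻ d ≡ binomialSum d (y ^ᶻ_)
  IH = [1+y]^d≡binomialSum y d

freshman's-dream : ∀ {p} → Prime p → ∀ y → (1ℤ + y) ^ᶻ p ≡ 1ℤ + y ^ᶻ p mod + p
freshman's-dream {p} pr y = begin
  (1ℤ + y) ^ᶻ p           ≡⟨ [1+y]^d≡binomialSum y p ⟩
  binomialSum p (y ^ᶻ_)   ≈⟨ binomialSum-prime pr (y ^ᶻ_) ⟩
  1ℤ + y ^ᶻ p             ∎
  where open ≡-mod-Reasoning (+ p)

shift-invariant⇒constant-mod : ∀ {m} (f : ℤ → ℤ) → (∀ y → f (1ℤ + y) ≡ f y mod m) →
                               ∀ y → f y ≡ f 0ℤ mod m
shift-invariant⇒constant-mod f shift (+ zero)        = mod-refl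
shift-invariant⇒constant-mod f shift (+ suc n)       =
  mod-trans (shift (+ n)) (shift-invariant⇒constant-mod f shift (+ n))
shift-invariant⇒constant-mod f shift -[1+ zero ]     = mod-sym (shift -[1+ zero ])
shift-invariant⇒constant-mod f shift -[1+ suc n ]    =
  mod-trans (mod-sym (shift -[1+ suc n ])) (shift-invariant⇒constant-mod f shift -[1+ n ])

fermat : ∀ {p} → Prime p → ∀ y → y ^ᶻ p ≡ y mod + p
-- F 0ℤ only computes to 0ℤ once p is seen to be a successor.
fermat {p@(suc _)} pr y = begin
  y ^ᶻ p                 ≡⟨ rearrange (y ^ᶻ p) y ⟩
  F y + y                ≈⟨ mod-+-congʳ y (shift-invariant⇒constant-mod F F-shift y) ⟩
  F 0ℤ + y               ≡⟨ +-identityˡ y ⟩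
  y                      ∎
  where
  open ≡-mod-Reasoning (+ p)
  F : ℤ → ℤ
  F y = y ^ᶻ p - y
  rearrange : ∀ a y → a ≡ (a - y) + y
  rearrange = solve-∀
  F-shift : ∀ y → F (1ℤ + y) ≡ F y mod + p
  F-shift y = begin
    (1ℤ + y) ^ᶻ p - (1ℤ + y)   ≈⟨ mod-+-congʳ (- (1ℤ + y)) (freshman's-dream pr y) ⟩
    1ℤ + y ^ᶻ p - (1ℤ + y)     ≡⟨ cancel (y ^ᶻ p) y ⟩
    y ^ᶻ p - y                 ∎
    where
    cancel : ∀ a y → 1ℤ + a - (1ℤ + y) ≡ a - y
    cancel = solve-∀

-- Chebyshev polynomials modulo a prime

T-cong-mod : ∀ {m x y} d → x ≡ y mod m → T d x ≡ T d y mod m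
T-cong-mod zero          x≡y = mod-refl
T-cong-mod (suc zero)    x≡y = x≡y
T-cong-mod (suc (suc d)) x≡y =
  mod-+-cong (mod-*-cong x≡y (T-cong-mod (suc d) x≡y)) (mod-neg-cong (T-cong-mod d x≡y))

-- Tℤ i (z + z⁻¹) = zⁱ + z⁻ⁱ
Tℤ : ℤ → ℤ → ℤ
Tℤ i = T (∣ i ∣)

T-recurrence : ∀ i x → x * Tℤ i x ≡ Tℤ (1ℤ + i) x + Tℤ (-1ℤ + i) x
T-recurrence (+ zero)       x = double x
  where
  double : ∀ x → x * + 2 ≡ x + x
  double = solve-∀
T-recurrence (+ suc n)      x = rearrange x (T (suc n) x) (T n x)
  where
  rearrange : ∀ x a b → x * a ≡ (x * a - b) + b
  rearrange = solve-∀
T-recurrence -[1+ zero ]    x = rearrange x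
  where
  rearrange : ∀ x → x * x ≡ + 2 + (x * x - + 2)
  rearrange = solve-∀
T-recurrence -[1+ suc n ]   x = rearrange x (T (suc (suc n)) x) (T (suc n) x)
  where
  rearrange : ∀ x a b → x * a ≡ b + (x * a - b)
  rearrange = solve-∀

x^d*Tℤ≡binomialSum : ∀ x d i → x ^ᶻ d * Tℤ i x ≡ binomialSum d (λ k → Tℤ (i + + d - + 2 * + k) x)
x^d*Tℤ≡binomialSum x zero    i = trans (*-identityˡ _) (cong (λ j → Tℤ j x) (rearrange i))
  where
  rearrange : ∀ i → i ≡ i + + 0 - + 2 * + 0
  rearrange = solve-∀
x^d*Tℤ≡binomialSum x (suc d) i = begin
  x * x ^ᶻ d * Tℤ i x                                ≡⟨ swap x (x ^ᶻ d) (Tℤ i x) ⟩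
  x ^ᶻ d * (x * Tℤ i x)                              ≡⟨ cong (x ^ᶻ d *_) (T-recurrence i x) ⟩
  x ^ᶻ d * (Tℤ (1ℤ + i) x + Tℤ (-1ℤ + i) x)          ≡⟨ *-distribˡ-+ (x ^ᶻ d) _ _ ⟩
  x ^ᶻ d * Tℤ (1ℤ + i) x + x ^ᶻ d * Tℤ (-1ℤ + i) x   ≡⟨ cong₂ _+_ (x^d*Tℤ≡binomialSum x d (1ℤ + i))
                                                                  (x^d*Tℤ≡binomialSum x d (-1ℤ + i)) ⟩
  binomialSum d (terms (1ℤ + i) d) + binomialSum d (terms (-1ℤ + i) d)
    ≡⟨ cong₂ _+_ (binomialSum-cong d λ k → cong (λ j → Tℤ j x) (shift-up i (+ d) (+ k)))
                 (binomialSum-cong d λ k → cong (λ j → Tℤ j x) (shift-down i (+ d) (+ k))) ⟩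
  binomialSum d (terms i (suc d)) + binomialSum d (λ k → terms i (suc d) (suc k)) ∎
  where
  open ≡-Reasoning
  terms : ℤ → ℕ → ℕ → ℤ
  terms j e k = Tℤ (j + + e - + 2 * + k) x
  swap : ∀ x a b → x * a * b ≡ a * (x * b)
  swap = solve-∀
  shift-up : ∀ i D K → 1ℤ + i + D - + 2 * K ≡ i + (1ℤ + D) - + 2 * K
  shift-up = solve-∀
  shift-down : ∀ i D K → -1ℤ + i + D - + 2 * K ≡ i + (1ℤ + D) - + 2 * (1ℤ + K)
  shift-down = solve-∀

x^p*2≡2*T-mod : ∀ {p} → Prime p → ∀ x → x ^ᶻ p * + 2 ≡ + 2 * T p x mod + p
x^p*2≡2*T-mod {p} pr x = begin
  x ^ᶻ p * Tℤ 0ℤ x                                     ≡⟨ x^d*Tℤ≡binomialSum x p 0ℤ ⟩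
  binomialSum p (λ k → Tℤ (0ℤ + + p - + 2 * + k) x)     ≈⟨ binomialSum-prime pr _ ⟩
  Tℤ (0ℤ + + p - + 2 * + 0) x + Tℤ (0ℤ + + p - + 2 * + p) x
    ≡⟨ cong₂ _+_ (cong (λ j → Tℤ j x) (first (+ p))) (cong (λ j → Tℤ j x) (last (+ p))) ⟩
  Tℤ (+ p) x + Tℤ (- + p) x                             ≡⟨ cong (λ n → T p x + T n x) (∣-i∣≡∣i∣ (+ p)) ⟩
  T p x + T p x                                         ≡⟨ double (T p x) ⟩
  + 2 * T p x                                           ∎
  where
  open ≡-mod-Reasoning (+ p)
  first : ∀ P → 0ℤ + P - + 2 * + 0 ≡ P
  first = solve-∀
  last : ∀ P → 0ℤ + P - + 2 * P ≡ - P
  last = solve-∀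
  double : ∀ a → a + a ≡ + 2 * a
  double = solve-∀

T-prime≡id-mod : ∀ {p} → Prime p → p % 2 ≡ 1 → ∀ x → T p x ≡ x mod + p
T-prime≡id-mod {p} pr odd x = mod-*-cancelˡ-2 pr odd (begin
  + 2 * T p x    ≈⟨ x^p*2≡2*T-mod pr x ⟨
  x ^ᶻ p * + 2   ≈⟨ mod-*-congʳ (+ 2) (fermat pr x) ⟩
  x * + 2        ≡⟨ *-comm x (+ 2) ⟩
  + 2 * x        ∎)
  where open ≡-mod-Reasoning (+ p)

-- Lifting congruences from ℓ to ℓ²

-- U d (z + z⁻¹) = (zᵈ − z⁻ᵈ) / (z − z⁻¹), and the derivative of T d is d · U d.
U : ℕ → ℤ → ℤ
U zero          x = 0ℤ
U (suc zero)    x = 1ℤ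
U (suc (suc d)) x = x * U (suc d) x - U d x

T≡xU-2U : ∀ d x → T (suc d) x ≡ x * U (suc d) x - + 2 * U d x
T≡xU-2U zero          x = rearrange x
  where
  rearrange : ∀ x → x ≡ x * 1ℤ - + 2 * 0ℤ
  rearrange = solve-∀
T≡xU-2U (suc zero)    x = rearrange x
  where
  rearrange : ∀ x → x * x - + 2 ≡ x * (x * 1ℤ - 0ℤ) - + 2 * 1ℤ
  rearrange = solve-∀
T≡xU-2U (suc (suc d)) x =
  trans (cong₂ (λ a b → x * a - b) (T≡xU-2U (suc d) x) (T≡xU-2U d x))
        (rearrange x (U (suc (suc d)) x) (U (suc d) x) (U d x))
  where
  rearrange : ∀ x u₂ u₁ u₀ →
    x * (x * u₂ - + 2 * u₁) - (x * u₁ - + 2 * u₀) ≡ x * (x * u₂ - u₁) - + 2 * (x * u₁ - u₀)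
  rearrange = solve-∀

T-taylor : ∀ d x h → T d (x + h) ≡ T d x + h * + d * U d x mod (h * h)
T-taylor zero          x h = mod-reflexive (rearrange h)
  where
  rearrange : ∀ h → + 2 ≡ + 2 + h * + 0 * 0ℤ
  rearrange = solve-∀
T-taylor (suc zero)    x h = mod-reflexive (rearrange x h)
  where
  rearrange : ∀ x h → x + h ≡ x + h * + 1 * 1ℤ
  rearrange = solve-∀
T-taylor (suc (suc d)) x h = begin
  (x + h) * T (suc d) (x + h) - T d (x + h)
    ≈⟨ mod-+-cong (mod-*-congˡ (x + h) (T-taylor (suc d) x h)) (mod-neg-cong (T-taylor d x h)) ⟩
  (x + h) * (T (suc d) x + h * + suc d * u₁) - (T d x + h * + d * u₀)
    ≡⟨ cong (λ a → (x + h) * (a + h * + suc d * u₁) - (T d x + h * + d * u₀)) (T≡xU-2U d x) ⟩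
  (x + h) * (x * u₁ - + 2 * u₀ + h * + suc d * u₁) - (T d x + h * + d * u₀)
    ≡⟨ expand x h u₁ u₀ (T d x) (+ d) ⟩
  x * (x * u₁ - + 2 * u₀) - T d x + h * + suc (suc d) * (x * u₁ - u₀) + + suc d * u₁ * (h * h)
    ≡⟨ cong (λ a → x * a - T d x + h * + suc (suc d) * (x * u₁ - u₀) + + suc d * u₁ * (h * h))
            (sym (T≡xU-2U d x)) ⟩
  taylor + + suc d * u₁ * (h * h)
    ≈⟨ mod-+-multiple taylor (+ suc d * u₁) ⟩
  taylor ∎
  where
  open ≡-mod-Reasoning (h * h)
  taylor : ℤ
  taylor = T (suc (suc d)) x + h * + suc (suc d) * U (suc (suc d)) x
  u₁ u₀ : ℤ
  u₁ = U (suc d) x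
  u₀ = U d x
  expand : ∀ x h u₁ u₀ b D →
    (x + h) * (x * u₁ - + 2 * u₀ + h * (1ℤ + D) * u₁) - (b + h * D * u₀) ≡
    x * (x * u₁ - + 2 * u₀) - b + h * (+ 2 + D) * (x * u₁ - u₀) + (1ℤ + D) * u₁ * (h * h)
  expand = solve-∀

T-lift-mod-square : ∀ p {x y} → x ≡ y mod + p → T p x ≡ T p y mod (+ p * + p)
T-lift-mod-square p {x} {y} (congruent (divides k x-y≡k*p)) = begin
  T p x                                  ≡⟨ cong (T p) (split x y) ⟩
  T p (y + (x - y))                      ≈⟨ mod-∣ p²∣[x-y]² (T-taylor p y (x - y)) ⟩
  T p y + (x - y) * + p * U p y          ≡⟨ cong (λ h → T p y + h * + p * U p y) x-y≡k*p ⟩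
  T p y + k * + p * + p * U p y          ≡⟨ regroup (T p y) k (+ p) (U p y) ⟩
  T p y + k * U p y * (+ p * + p)        ≈⟨ mod-+-multiple (T p y) (k * U p y) ⟩
  T p y                                  ∎
  where
  open ≡-mod-Reasoning (+ p * + p)
  split : ∀ x y → x ≡ y + (x - y)
  split = solve-∀
  regroup : ∀ a k P u → a + k * P * P * u ≡ a + k * u * (P * P)
  regroup = solve-∀
  square : ∀ k P → k * P * (k * P) ≡ k * k * (P * P)
  square = solve-∀
  p²∣[x-y]² : + p * + p ∣ₛ (x - y) * (x - y)
  p²∣[x-y]² = divides (k * k) (trans (cong₂ _*_ x-y≡k*p x-y≡k*p) (square k (+ p)))

iterate-fixed-mod : ∀ {m} (f : ℤ → ℤ) → (∀ {x y} → x ≡ y mod m → f x ≡ f y mod m) →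
                    ∀ {t} → f t ≡ t mod m → ∀ n → (f ^[ n ]) t ≡ t mod m
iterate-fixed-mod f f-cong ft≡t zero    = mod-refl
iterate-fixed-mod f f-cong ft≡t (suc n) =
  mod-trans (f-cong (iterate-fixed-mod f f-cong ft≡t n)) ft≡t

T-fixed-mod-square : ∀ {p a t} → Prime p → p % 2 ≡ 1 →
                     t ≡ T p a mod (+ p * + p) → T p t ≡ t mod (+ p * + p)
T-fixed-mod-square {p} {a} {t} pr odd t≡Ta = mod-trans (T-lift-mod-square p t≡a) (mod-sym t≡Ta)
  where
  t≡a : t ≡ a mod + p
  t≡a = mod-trans (mod-∣ (divides (+ p) refl) t≡Ta) (T-prime≡id-mod pr odd a)

theorem3p6 : (ℓ n : ℕ) (t : ℤ) → Prime ℓ → ℓ % 2 ≡ 1 → n ≥ 1 →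
    ((+ (ℓ ^ 2)) ∣ Φ ℓ n t t) ⇔ (∃ λ (a : ℤ) → (+ (ℓ ^ 2)) ∣ (t - T ℓ a))
theorem3p6 ℓ zero    t pr odd ()
theorem3p6 ℓ (suc n) t pr odd _ = mk⇔ periodic⇒image image⇒periodic
  where
  ℓ²≡ℓ*ℓ : + (ℓ ^ 2) ≡ + ℓ * + ℓ
  ℓ²≡ℓ*ℓ = trans (cong (λ m → + (ℓ ℕ.* m)) (*-identityʳ ℓ)) (pos-* ℓ ℓ)
  to-mod : ∀ x y → + (ℓ ^ 2) ∣ x - y → x ≡ y mod (+ ℓ * + ℓ)
  to-mod _ _ ℓ²∣x-y = congruent (subst (_∣ₛ _) ℓ²≡ℓ*ℓ (∣ᵤ⇒∣ ℓ²∣x-y))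
  from-mod : ∀ x y → x ≡ y mod (+ ℓ * + ℓ) → + (ℓ ^ 2) ∣ x - y
  from-mod _ _ (congruent ℓ²∣x-y) = ∣⇒∣ᵤ (subst (_∣ₛ _) (sym ℓ²≡ℓ*ℓ) ℓ²∣x-y)
  Tⁿt : ℤ
  Tⁿt = (T ℓ ^[ n ]) t
  periodic⇒image : + (ℓ ^ 2) ∣ T ℓ Tⁿt - t → ∃ λ a → + (ℓ ^ 2) ∣ t - T ℓ a
  periodic⇒image Φ≡0 = Tⁿt , from-mod t (T ℓ Tⁿt) (mod-sym (to-mod (T ℓ Tⁿt) t Φ≡0))
  image⇒periodic : (∃ λ a → + (ℓ ^ 2) ∣ t - T ℓ a) → + (ℓ ^ 2) ∣ T ℓ Tⁿt - t
  image⇒periodic (a , t≡Ta) = from-mod (T ℓ Tⁿt) t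
    (iterate-fixed-mod (T ℓ) (T-cong-mod ℓ)
      (T-fixed-mod-square pr odd (to-mod t (T ℓ a) t≡Ta)) (suc n))
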